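{- For every $n\ge 0$, the sequence $\Lambda_n$ contains every chain of the Greene–Kleitman symmetric chain decomposition of $Q_n$ exactly once.
   Context: Let $D$ be the set of bitstrings (including the empty string $\varepsilon$) with equally many 0s and 1s such that every prefix has at least as many 0s as 1s. The chains of the Greene–Kleitman decomposition of $Q_n$ are exactly the strings $C=u_0*u_1*\cdots*u_h$ of length $n$ over $\{0,1,*\}$ with $u_0,\ldots,u_h\in D$ (the chain's vertices are obtained by replacing the $*$s by $i$ ones followed by $h-i$ zeros); $|C|=h$ is its length. For $|C|\ge 2$, $f(C)$ (resp. $\ell(C)$) replaces the first two (resp. last two) $*$s by $0$ and $1$ respectively. ${*}C{*}$ denotes $C$ with $*$ prepended and appended, $0C1$ denotes $C$ with $0$ prepended and $1$ appended, $\Gamma^R$ the reversal of a sequence. Even $n$: $\Lambda_0:=\varepsilon$, and if $\Lambda_n=C_1,\ldots,C_N$ then $\Lambda_{n+2}:=\rho(C_1),\ldots,\rho(C_N)$ where $\rho(C):=\lambda(C)$ if $|C|\equiv n\pmod 4$ and $\rho(C):=\lambda(C)^R$ otherwise, with $\lambda(C):={*}C{*},f({*}C{*}),f(\ell({*}C{*})),\ell({*}C{*})$ if $|C|\ge2$ and $\lambda(C):={*}C{*},0C1$ if $|C|=0$. Odd $n$: $\Lambda_1:={*}$, and $\Lambda_{n+2}:=\rho(C_1),\ldots,\rho(C_N)$ with $\rho$ as before but $\lambda(C):={*}C{*},\ell({*}C{*}),\ell(f({*}C{*})),f({*}C{*})$ if $|C|\ge3$ and $\lambda(C):={*}C{*},\ell({*}C{*}),f({*}C{*})$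 if $|C|=1$. -}

module Defs where

open import Data.Nat using (ℕ; zero; suc; _≤_; _%_; _≡ᵇ_)
open import Data.Bool using (Bool; true; false; if_then_else_; _∧_)
open import Data.List using (List; []; _∷_; _++_; [_]; length; reverse; concatMap; concat; intersperse)
open import Data.List.Relation.Unary.All using (All)
open import Data.Product using (∃; _×_)
open import Data.Sum using (_⊎_)
open import Relation.Binary.PropositionalEquality using (_≡_)

data Sym : Set where
  𝟘 𝟙 ⋆ : Sym

Word : Set
Word = List Sym

#0 #1 #⋆ : Word → ℕ
#0 [] = 0
#0 (𝟘 ∷ w) = suc (#0 w)
#0 (_ ∷ w) = #0 w
#1 [] = 0
#1 (𝟙 ∷ w) = suc (#1 w)
#1 (_ ∷ w) = #1 w
#⋆ [] = 0
#⋆ (⋆ ∷ w) = suc (#⋆ w)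
#⋆ (_ ∷ w) = #⋆ w

IsBit : Sym → Set
IsBit s = (s ≡ 𝟘) ⊎ (s ≡ 𝟙)

InD : Word → Set
InD w = All IsBit w × (#0 w ≡ #1 w)
      × (∀ (p s : Word) → p ++ s ≡ w → #1 p ≤ #0 p)

IsGKChain : ℕ → Word → Set
IsGKChain n C = length C ≡ n
  × ∃ λ (u₀ : Word) → ∃ λ (us : List Word) →
      All InD (u₀ ∷ us) × (C ≡ concat (intersperse [ ⋆ ] (u₀ ∷ us)))

replace2 : Sym → Sym → Word → Word
replace2 a b [] = []
replace2 a b (⋆ ∷ w) = a ∷ replace1 w
  where
    replace1 : Word → Word
    replace1 [] = []
    replace1 (⋆ ∷ v) = b ∷ v
    replace1 (x ∷ v) = x ∷ replace1 v
replace2 a b (x ∷ w) = x ∷ replace2 a b w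

f : Word → Word
f C = replace2 𝟘 𝟙 C

-- ℓ(C): last two *s replaced by 0 and 1 respectively
-- (the earlier one by 0, the later one by 1)
ℓ : Word → Word
ℓ C = reverse (replace2 𝟙 𝟘 (reverse C))

star : Word → Word
star C = ⋆ ∷ (C ++ [ ⋆ ])

wrap01 : Word → Word
wrap01 C = 𝟘 ∷ (C ++ [ 𝟙 ])

-- λ for even n (|C| = 0 or |C| ≥ 2 ; |C| = 1 never occurs for even n)
λeven : Word → List Word
λeven C with #⋆ C
... | zero = star C ∷ wrap01 C ∷ []
... | suc _ = star C ∷ f (star C) ∷ f (ℓ (star C)) ∷ ℓ (star C) ∷ []

-- λ for odd n (|C| = 1 or |C| ≥ 3 ; |C| = 0 never occurs for odd n)
λodd : Word → List Word
λodd C with #⋆ C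
... | suc zero = star C ∷ ℓ (star C) ∷ f (star C) ∷ []
... | _ = star C ∷ ℓ (star C) ∷ ℓ (f (star C)) ∷ f (star C) ∷ []

even? : ℕ → Bool
even? zero = true
even? (suc zero) = false
even? (suc (suc n)) = even? n

ρ : ℕ → Word → List Word
ρ n C = let lam = if even? n then λeven C else λodd C in
        if (#⋆ C % 4) ≡ᵇ (n % 4) then lam else reverse lam

Λ : ℕ → List Word
Λ zero = [ [] ]
Λ (suc zero) = [ [ ⋆ ] ]
Λ (suc (suc n)) = concatMap (ρ n) (Λ n)

_==ˢ_ : Sym → Sym → Bool
𝟘 ==ˢ 𝟘 = true
𝟙 ==ˢ 𝟙 = true
⋆ ==ˢ ⋆ = true
_ ==ˢ _ = false

_==_ : Word → Word → Bool
[] == [] = true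
(x ∷ v) == (y ∷ w) = (x ==ˢ y) ∧ (v == w)
_ == _ = false

multiplicity : Word → List Word → ℕ
multiplicity C [] = 0
multiplicity C (D ∷ Ds) = if C == D then suc (multiplicity C Ds) else multiplicity C Ds

-- Every chain x of length n + 2 comes from a unique chain M of length n, its parent, as
-- one of the children *M*, f(*M*), ℓ(*M*), f(ℓ(*M*)), the last two only when M has at
-- least one, resp. two, stars.  The parent is recovered by undoing f (a leading 0 and its
-- matching 1 become stars again), then undoing ℓ, which is f conjugated by the mirror
-- symmetry (reverse and swap 0 ↔ 1), and removing the two outer stars.  Up to order, ρ n M
-- lists exactly these children, each once (the parity of |M| is that of n, which rules
-- out the cases λ does not cover), so x occurs in Λ (n + 2) as often as its parent occurs
-- in Λ n, and induction on n concludes.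

module Submission where

open import Defs
open import Data.Nat using (ℕ; zero; suc; _+_; _≤_; _%_; _≡ᵇ_; s≤s; z≤n)
open import Data.Nat.Properties
  using (+-comm; +-identityʳ; +-suc; suc-injective; ≤-pred; ≤-refl; ≤-trans; <⇒≤)
open import Data.Bool using (true; false; not; if_then_else_)
open import Data.List
  using (List; []; _∷_; _++_; [_]; length; map; reverse; concat; concatMap; intersperse; drop;
         initLast; _∷ʳ′_)
open import Data.List.Properties
  using (map-++; map-∘; map-cong; map-id; length-++; length-map; length-reverse; reverse-++; reverse-map;
         reverse-involutive; unfold-reverse; ∷-injectiveˡ; ∷-injectiveʳ; ∷ʳ-injective)
open import Data.List.Relation.Unary.All as All using (All; []; _∷_)
open import Data.List.Relation.Unary.All.Properties using (concat⁺; map⁺)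
open import Data.List.Relation.Unary.AllPairs using ([]; _∷_)
open import Data.List.Relation.Unary.Unique.Propositional using (Unique)
open import Data.List.Relation.Unary.Any using (here; there)
open import Data.List.Membership.Propositional using (_∈_)
open import Data.List.Relation.Binary.Permutation.Propositional as Perm
  using (_↭_; prep; swap; ↭-refl; ↭-reflexive; ↭-trans; ↭-sym)
open import Data.List.Relation.Binary.Permutation.Propositional.Properties
  using (↭-reverse; All-resp-↭)
open import Data.Product using (∃; _×_; _,_; proj₁; proj₂)
open import Data.Sum using (_⊎_; inj₁; inj₂)
open import Data.Empty using (⊥-elim)
open import Function using (_∘_)
open import Relation.Nullary using (¬_; Dec; yes; no)
open import Relation.Binary.Definitions using (DecidableEquality)
open import Relation.Binary.PropositionalEquality hiding ([_])
open ≡-Reasoning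

-- A word is read as a lattice path: 𝟘 steps up, 𝟙 steps down, and ⋆ is a flat
-- step allowed only at height 0.  The chains u₀ * u₁ * ⋯ * u_h are exactly the
-- words of closed paths at height 0.
data Path : ℕ → Word → ℕ → Set where
  end  : ∀ {i} → Path i [] i
  up   : ∀ {i w j} → Path (suc i) w j → Path i (𝟘 ∷ w) j
  down : ∀ {i w j} → Path i w j → Path (suc i) (𝟙 ∷ w) j
  flat : ∀ {w j} → Path 0 w j → Path 0 (⋆ ∷ w) j

Chain : Word → Set
Chain w = Path 0 w 0

Path-++ : ∀ {i a j b k} → Path i a j → Path j b k → Path i (a ++ b) k
Path-++ end      q = q
Path-++ (up p)   q = up (Path-++ p q)
Path-++ (down p) q = down (Path-++ p q)
Path-++ (flat p) q = flat (Path-++ p q)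

Path-++⁻ : ∀ a {b i k} → Path i (a ++ b) k → ∃ λ j → Path i a j × Path j b k
Path-++⁻ []      p        = _ , end , p
Path-++⁻ (𝟘 ∷ a) (up p)   = let j , q , r = Path-++⁻ a p in j , up q , r
Path-++⁻ (𝟙 ∷ a) (down p) = let j , q , r = Path-++⁻ a p in j , down q , r
Path-++⁻ (⋆ ∷ a) (flat p) = let j , q , r = Path-++⁻ a p in j , flat q , r

¬Chain-∷ʳ𝟘 : ∀ a → ¬ Chain (a ++ [ 𝟘 ])
¬Chain-∷ʳ𝟘 a p with Path-++⁻ a p
... | _ , _ , up ()

Chain-star : ∀ {M} → Chain M → Chain (star M)
Chain-star c = flat (Path-++ c (flat end))

Chain-star⁻ : ∀ {M} → Chain (star M) → Chain M
Chain-star⁻ {M} (flat p) with Path-++⁻ M p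
... | _ , c , flat end = c

-- Mirror symmetry

complement : Sym → Sym
complement 𝟘 = 𝟙
complement 𝟙 = 𝟘
complement ⋆ = ⋆

complement-involutive : ∀ x → complement (complement x) ≡ x
complement-involutive 𝟘 = refl
complement-involutive 𝟙 = refl
complement-involutive ⋆ = refl

map-complement-involutive : ∀ w → map complement (map complement w) ≡ w
map-complement-involutive w = begin
  map complement (map complement w) ≡⟨ sym (map-∘ w) ⟩
  map (complement ∘ complement) w   ≡⟨ map-cong complement-involutive w ⟩
  map (λ x → x) w                   ≡⟨ map-id w ⟩
  w                                 ∎

mirror : Word → Word
mirror w = reverse (map complement w)

mirror-∷ : ∀ x w → mirror (x ∷ w) ≡ mirror w ++ [ complement x ]
mirror-∷ x w = unfold-reverse (complement x) (map complement w)

mirror-++ : ∀ a b → mirror (a ++ b) ≡ mirror b ++ mirror a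
mirror-++ a b =
  trans (cong reverse (map-++ complement a b)) (reverse-++ (map complement a) (map complement b))

mirror-∷ʳ : ∀ w x → mirror (w ++ [ x ]) ≡ complement x ∷ mirror w
mirror-∷ʳ w x = mirror-++ w [ x ]

mirror-involutive : ∀ w → mirror (mirror w) ≡ w
mirror-involutive w = begin
  reverse (map complement (reverse (map complement w)))
    ≡⟨ cong reverse (reverse-map complement (map complement w)) ⟩
  reverse (reverse (map complement (map complement w)))
    ≡⟨ reverse-involutive _ ⟩
  map complement (map complement w)
    ≡⟨ map-complement-involutive w ⟩
  w ∎

mirror-wrap : ∀ a w b → mirror (a ∷ w ++ [ b ]) ≡ complement b ∷ mirror w ++ [ complement a ]
mirror-wrap a w b = trans (mirror-∷ a (w ++ [ b ])) (cong (_++ [ complement a ]) (mirror-∷ʳ w b))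

mirror-star : ∀ M → mirror (star M) ≡ star (mirror M)
mirror-star M = mirror-wrap ⋆ M ⋆

length-mirror : ∀ w → length (mirror w) ≡ length w
length-mirror w = trans (length-reverse (map complement w)) (length-map complement w)

Path-mirror : ∀ {i w j} → Path i w j → Path j (mirror w) i
Path-mirror end = end
Path-mirror (up {w = w} p)   rewrite mirror-∷ 𝟘 w = Path-++ (Path-mirror p) (down end)
Path-mirror (down {w = w} p) rewrite mirror-∷ 𝟙 w = Path-++ (Path-mirror p) (up end)
Path-mirror (flat {w = w} p) rewrite mirror-∷ ⋆ w = Path-++ (Path-mirror p) (flat end)

#⋆-++ : ∀ a b → #⋆ (a ++ b) ≡ #⋆ a + #⋆ b
#⋆-++ []      b = refl
#⋆-++ (𝟘 ∷ a) b = #⋆-++ a b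
#⋆-++ (𝟙 ∷ a) b = #⋆-++ a b
#⋆-++ (⋆ ∷ a) b = cong suc (#⋆-++ a b)

#⋆-mirror : ∀ w → #⋆ (mirror w) ≡ #⋆ w
#⋆-mirror [] = refl
#⋆-mirror (x ∷ w) rewrite mirror-∷ x w | #⋆-++ (mirror w) [ complement x ] | #⋆-mirror w with x
... | 𝟘 = +-identityʳ (#⋆ w)
... | 𝟙 = +-identityʳ (#⋆ w)
... | ⋆ = +-comm (#⋆ w) 1

≤-#⋆-mirror : ∀ {k} w → k ≤ #⋆ w → k ≤ #⋆ (mirror w)
≤-#⋆-mirror w = subst (_ ≤_) (sym (#⋆-mirror w))

1≤#⋆-∷ʳ⋆ : ∀ w → 1 ≤ #⋆ (w ++ [ ⋆ ])
1≤#⋆-∷ʳ⋆ w rewrite #⋆-++ w [ ⋆ ] | +-comm (#⋆ w) 1 = s≤s z≤n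

#⋆-star : ∀ M → #⋆ (star M) ≡ 2 + #⋆ M
#⋆-star M = cong suc (trans (#⋆-++ M [ ⋆ ]) (+-comm (#⋆ M) 1))

length-star : ∀ M → length (star M) ≡ 2 + length M
length-star M = cong suc (trans (length-++ M) (+-comm (length M) 1))

-- Raising and lowering stars

replaceFirst : Sym → Word → Word
replaceFirst b []      = []
replaceFirst b (⋆ ∷ w) = b ∷ w
replaceFirst b (𝟘 ∷ w) = 𝟘 ∷ replaceFirst b w
replaceFirst b (𝟙 ∷ w) = 𝟙 ∷ replaceFirst b w

replaceFirst-++ : ∀ b a c → 1 ≤ #⋆ a → replaceFirst b (a ++ c) ≡ replaceFirst b a ++ c
replaceFirst-++ b (⋆ ∷ a) c h = refl
replaceFirst-++ b (𝟘 ∷ a) c h = cong (𝟘 ∷_) (replaceFirst-++ b a c h)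
replaceFirst-++ b (𝟙 ∷ a) c h = cong (𝟙 ∷_) (replaceFirst-++ b a c h)

replaceFirst-starFree : ∀ b a c → #⋆ a ≡ 0 → replaceFirst b (a ++ ⋆ ∷ c) ≡ a ++ b ∷ c
replaceFirst-starFree b []      c h = refl
replaceFirst-starFree b (𝟘 ∷ a) c h = cong (𝟘 ∷_) (replaceFirst-starFree b a c h)
replaceFirst-starFree b (𝟙 ∷ a) c h = cong (𝟙 ∷_) (replaceFirst-starFree b a c h)

length-replaceFirst : ∀ b w → length (replaceFirst b w) ≡ length w
length-replaceFirst b []      = refl
length-replaceFirst b (⋆ ∷ w) = refl
length-replaceFirst b (𝟘 ∷ w) = cong suc (length-replaceFirst b w)
length-replaceFirst b (𝟙 ∷ w) = cong suc (length-replaceFirst b w)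

map-complement-replaceFirst : ∀ b w →
  map complement (replaceFirst b w) ≡ replaceFirst (complement b) (map complement w)
map-complement-replaceFirst b []      = refl
map-complement-replaceFirst b (⋆ ∷ w) = refl
map-complement-replaceFirst b (𝟘 ∷ w) = cong (𝟙 ∷_) (map-complement-replaceFirst b w)
map-complement-replaceFirst b (𝟙 ∷ w) = cong (𝟘 ∷_) (map-complement-replaceFirst b w)

raise : Word → Word
raise = replaceFirst 𝟙

#⋆-raise : ∀ w → 1 ≤ #⋆ w → suc (#⋆ (raise w)) ≡ #⋆ w
#⋆-raise (⋆ ∷ w) h = refl
#⋆-raise (𝟘 ∷ w) h = #⋆-raise w h
#⋆-raise (𝟙 ∷ w) h = #⋆-raise w h

Path-raise : ∀ {k w} → Path k w 0 → 1 ≤ #⋆ w → Path (suc k) (raise w) 0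
Path-raise (up p)   h = up (Path-raise p h)
Path-raise (down p) h = down (Path-raise p h)
Path-raise (flat p) h = down p

unraise : ℕ → Word → Word
unraise k       []      = []
unraise k       (𝟘 ∷ w) = 𝟘 ∷ unraise (suc k) w
unraise zero    (𝟙 ∷ w) = ⋆ ∷ w
unraise (suc k) (𝟙 ∷ w) = 𝟙 ∷ unraise k w
unraise k       (⋆ ∷ w) = ⋆ ∷ unraise k w

unraise-raise : ∀ {k w} → Path k w 0 → 1 ≤ #⋆ w → unraise k (raise w) ≡ w
unraise-raise (up p)   h = cong (𝟘 ∷_) (unraise-raise p h)
unraise-raise (down p) h = cong (𝟙 ∷_) (unraise-raise p h)
unraise-raise (flat p) h = refl

raise-unraise : ∀ {k w} → Path (suc k) w 0 → raise (unraise k w) ≡ w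
raise-unraise         (up p)   = cong (𝟘 ∷_) (raise-unraise p)
raise-unraise {zero}  (down p) = refl
raise-unraise {suc k} (down p) = cong (𝟙 ∷_) (raise-unraise p)

Path-unraise : ∀ {k w} → Path (suc k) w 0 → Path k (unraise k w) 0
Path-unraise         (up p)   = up (Path-unraise p)
Path-unraise {zero}  (down p) = flat p
Path-unraise {suc k} (down p) = down (Path-unraise p)

#⋆-unraise : ∀ {k w} → Path (suc k) w 0 → #⋆ (unraise k w) ≡ suc (#⋆ w)
#⋆-unraise         (up p)   = #⋆-unraise p
#⋆-unraise {zero}  (down p) = refl
#⋆-unraise {suc k} (down p) = #⋆-unraise p

length-unraise : ∀ k w → length (unraise k w) ≡ length w
length-unraise k       []      = refl
length-unraise k       (𝟘 ∷ w) = cong suc (length-unraise (suc k) w)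
length-unraise zero    (𝟙 ∷ w) = refl
length-unraise (suc k) (𝟙 ∷ w) = cong suc (length-unraise k w)
length-unraise k       (⋆ ∷ w) = cong suc (length-unraise k w)

-- lower w replaces the last ⋆ of w by 𝟘.
lower : Word → Word
lower w = mirror (raise (mirror w))

lower-∷ : ∀ x w → 1 ≤ #⋆ w → lower (x ∷ w) ≡ x ∷ lower w
lower-∷ x w h = begin
  mirror (raise (mirror (x ∷ w)))                ≡⟨ cong (mirror ∘ raise) (mirror-∷ x w) ⟩
  mirror (raise (mirror w ++ [ complement x ]))  ≡⟨ cong mirror (replaceFirst-++ 𝟙 (mirror w) _ (≤-#⋆-mirror w h)) ⟩
  mirror (raise (mirror w) ++ [ complement x ])  ≡⟨ mirror-∷ʳ (raise (mirror w)) (complement x) ⟩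
  complement (complement x) ∷ lower w            ≡⟨ cong (_∷ lower w) (complement-involutive x) ⟩
  x ∷ lower w                                    ∎

#⋆-lower : ∀ w → 1 ≤ #⋆ w → suc (#⋆ (lower w)) ≡ #⋆ w
#⋆-lower w h = begin
  suc (#⋆ (mirror (raise (mirror w)))) ≡⟨ cong suc (#⋆-mirror (raise (mirror w))) ⟩
  suc (#⋆ (raise (mirror w)))          ≡⟨ #⋆-raise (mirror w) (≤-#⋆-mirror w h) ⟩
  #⋆ (mirror w)                        ≡⟨ #⋆-mirror w ⟩
  #⋆ w                                 ∎

1≤#⋆-raise : ∀ w → 2 ≤ #⋆ w → 1 ≤ #⋆ (raise w)
1≤#⋆-raise w h = ≤-pred (subst (2 ≤_) (sym (#⋆-raise w (<⇒≤ h))) h)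

1≤#⋆-lower : ∀ w → 2 ≤ #⋆ w → 1 ≤ #⋆ (lower w)
1≤#⋆-lower w h = ≤-pred (subst (2 ≤_) (sym (#⋆-lower w (<⇒≤ h))) h)

lower∘raise≡raise∘lower : ∀ w → 2 ≤ #⋆ w → lower (raise w) ≡ raise (lower w)
lower∘raise≡raise∘lower (⋆ ∷ w) h =
  trans (lower-∷ 𝟙 w (≤-pred h)) (cong raise (sym (lower-∷ ⋆ w (≤-pred h))))
lower∘raise≡raise∘lower (𝟘 ∷ w) h = begin
  lower (𝟘 ∷ raise w) ≡⟨ lower-∷ 𝟘 (raise w) (1≤#⋆-raise w h) ⟩
  𝟘 ∷ lower (raise w) ≡⟨ cong (𝟘 ∷_) (lower∘raise≡raise∘lower w h) ⟩
  𝟘 ∷ raise (lower w) ≡⟨ cong raise (sym (lower-∷ 𝟘 w (<⇒≤ h))) ⟩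
  raise (lower (𝟘 ∷ w)) ∎
lower∘raise≡raise∘lower (𝟙 ∷ w) h = begin
  lower (𝟙 ∷ raise w) ≡⟨ lower-∷ 𝟙 (raise w) (1≤#⋆-raise w h) ⟩
  𝟙 ∷ lower (raise w) ≡⟨ cong (𝟙 ∷_) (lower∘raise≡raise∘lower w h) ⟩
  𝟙 ∷ raise (lower w) ≡⟨ cong raise (sym (lower-∷ 𝟙 w (<⇒≤ h))) ⟩
  raise (lower (𝟙 ∷ w)) ∎

replace2-⋆ : ∀ a b w → replace2 a b (⋆ ∷ w) ≡ a ∷ replaceFirst b w
replace2-⋆ a b []      = refl
replace2-⋆ a b (⋆ ∷ w) = refl
replace2-⋆ a b (𝟘 ∷ w) = cong (λ v → a ∷ 𝟘 ∷ v) (∷-injectiveʳ (replace2-⋆ a b w))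
replace2-⋆ a b (𝟙 ∷ w) = cong (λ v → a ∷ 𝟙 ∷ v) (∷-injectiveʳ (replace2-⋆ a b w))

f-⋆ : ∀ w → f (⋆ ∷ w) ≡ 𝟘 ∷ raise w
f-⋆ = replace2-⋆ 𝟘 𝟙

length-replace2 : ∀ a b w → length (replace2 a b w) ≡ length w
length-replace2 a b []      = refl
length-replace2 a b (⋆ ∷ w) =
  trans (cong length (replace2-⋆ a b w)) (cong suc (length-replaceFirst b w))
length-replace2 a b (𝟘 ∷ w) = cong suc (length-replace2 a b w)
length-replace2 a b (𝟙 ∷ w) = cong suc (length-replace2 a b w)

#⋆-f : ∀ w → 2 ≤ #⋆ w → 2 + #⋆ (f w) ≡ #⋆ w
#⋆-f (⋆ ∷ w) (s≤s h) = trans (cong (λ v → 2 + #⋆ v) (f-⋆ w)) (cong suc (#⋆-raise w h))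
#⋆-f (𝟘 ∷ w) h = #⋆-f w h
#⋆-f (𝟙 ∷ w) h = #⋆-f w h

Path-f : ∀ {k w} → Path k w 0 → 2 ≤ #⋆ w → Path k (f w) 0
Path-f (up p)   h = up (Path-f p h)
Path-f (down p) h = down (Path-f p h)
Path-f (flat {w = w} p) (s≤s h) = subst Chain (sym (f-⋆ w)) (up (Path-raise p h))

map-complement-f : ∀ w → map complement (f w) ≡ replace2 𝟙 𝟘 (map complement w)
map-complement-f []      = refl
map-complement-f (⋆ ∷ w) = begin
  map complement (f (⋆ ∷ w))          ≡⟨ cong (map complement) (f-⋆ w) ⟩
  𝟙 ∷ map complement (raise w)        ≡⟨ cong (𝟙 ∷_) (map-complement-replaceFirst 𝟙 w) ⟩
  𝟙 ∷ replaceFirst 𝟘 (map complement w) ≡⟨ sym (replace2-⋆ 𝟙 𝟘 (map complement w)) ⟩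
  replace2 𝟙 𝟘 (⋆ ∷ map complement w) ∎
map-complement-f (𝟘 ∷ w) = cong (𝟙 ∷_) (map-complement-f w)
map-complement-f (𝟙 ∷ w) = cong (𝟘 ∷_) (map-complement-f w)

ℓ-dual : ∀ w → ℓ w ≡ mirror (f (mirror w))
ℓ-dual w = sym (begin
  reverse (map complement (f (reverse (map complement w))))
    ≡⟨ cong reverse (map-complement-f (reverse (map complement w))) ⟩
  reverse (replace2 𝟙 𝟘 (map complement (reverse (map complement w))))
    ≡⟨ cong (reverse ∘ replace2 𝟙 𝟘) (reverse-map complement (map complement w)) ⟩
  reverse (replace2 𝟙 𝟘 (reverse (map complement (map complement w))))
    ≡⟨ cong (reverse ∘ replace2 𝟙 𝟘 ∘ reverse) (map-complement-involutive w) ⟩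
  ℓ w ∎)

length-f : ∀ w → length (f w) ≡ length w
length-f = length-replace2 𝟘 𝟙

length-ℓ : ∀ w → length (ℓ w) ≡ length w
length-ℓ w = begin
  length (ℓ w)                   ≡⟨ cong length (ℓ-dual w) ⟩
  length (mirror (f (mirror w))) ≡⟨ length-mirror (f (mirror w)) ⟩
  length (f (mirror w))          ≡⟨ length-f (mirror w) ⟩
  length (mirror w)              ≡⟨ length-mirror w ⟩
  length w                       ∎

#⋆-ℓ : ∀ w → 2 ≤ #⋆ w → 2 + #⋆ (ℓ w) ≡ #⋆ w
#⋆-ℓ w h = begin
  2 + #⋆ (ℓ w)                   ≡⟨ cong (λ v → 2 + #⋆ v) (ℓ-dual w) ⟩
  2 + #⋆ (mirror (f (mirror w))) ≡⟨ cong (2 +_) (#⋆-mirror (f (mirror w))) ⟩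
  2 + #⋆ (f (mirror w))          ≡⟨ #⋆-f (mirror w) (≤-#⋆-mirror w h) ⟩
  #⋆ (mirror w)                  ≡⟨ #⋆-mirror w ⟩
  #⋆ w                           ∎

Chain-ℓ : ∀ {w} → Chain w → 2 ≤ #⋆ w → Chain (ℓ w)
Chain-ℓ {w} c h = subst Chain (sym (ℓ-dual w))
  (Path-mirror (Path-f (Path-mirror c) (≤-#⋆-mirror w h)))

ℓ-∷ʳ⋆ : ∀ w → ℓ (w ++ [ ⋆ ]) ≡ lower w ++ [ 𝟙 ]
ℓ-∷ʳ⋆ w = begin
  ℓ (w ++ [ ⋆ ])                     ≡⟨ ℓ-dual (w ++ [ ⋆ ]) ⟩
  mirror (f (mirror (w ++ [ ⋆ ])))   ≡⟨ cong (mirror ∘ f) (mirror-∷ʳ w ⋆) ⟩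
  mirror (f (⋆ ∷ mirror w))          ≡⟨ cong mirror (f-⋆ (mirror w)) ⟩
  mirror (𝟘 ∷ raise (mirror w))      ≡⟨ mirror-∷ 𝟘 (raise (mirror w)) ⟩
  lower w ++ [ 𝟙 ]                   ∎

f-star : ∀ M → 1 ≤ #⋆ M → f (star M) ≡ 𝟘 ∷ raise M ++ [ ⋆ ]
f-star M h = trans (f-⋆ (M ++ [ ⋆ ])) (cong (𝟘 ∷_) (replaceFirst-++ 𝟙 M [ ⋆ ] h))

f-star-starFree : ∀ M → #⋆ M ≡ 0 → f (star M) ≡ wrap01 M
f-star-starFree M h = trans (f-⋆ (M ++ [ ⋆ ])) (cong (𝟘 ∷_) (replaceFirst-starFree 𝟙 M [] h))

ℓ-star : ∀ M → 1 ≤ #⋆ M → ℓ (star M) ≡ ⋆ ∷ lower M ++ [ 𝟙 ]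
ℓ-star M h = trans (ℓ-∷ʳ⋆ (⋆ ∷ M)) (cong (_++ [ 𝟙 ]) (lower-∷ ⋆ M h))

f∘ℓ-star : ∀ M → 2 ≤ #⋆ M → f (ℓ (star M)) ≡ 𝟘 ∷ raise (lower M) ++ [ 𝟙 ]
f∘ℓ-star M h = begin
  f (ℓ (star M))                 ≡⟨ cong f (ℓ-star M (<⇒≤ h)) ⟩
  f (⋆ ∷ lower M ++ [ 𝟙 ])       ≡⟨ f-⋆ (lower M ++ [ 𝟙 ]) ⟩
  𝟘 ∷ raise (lower M ++ [ 𝟙 ])   ≡⟨ cong (𝟘 ∷_) (replaceFirst-++ 𝟙 (lower M) [ 𝟙 ] (1≤#⋆-lower M h)) ⟩
  𝟘 ∷ raise (lower M) ++ [ 𝟙 ]   ∎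

ℓ∘f-star : ∀ M → 2 ≤ #⋆ M → ℓ (f (star M)) ≡ 𝟘 ∷ lower (raise M) ++ [ 𝟙 ]
ℓ∘f-star M h = begin
  ℓ (f (star M))                 ≡⟨ cong ℓ (f-star M (<⇒≤ h)) ⟩
  ℓ ((𝟘 ∷ raise M) ++ [ ⋆ ])     ≡⟨ ℓ-∷ʳ⋆ (𝟘 ∷ raise M) ⟩
  lower (𝟘 ∷ raise M) ++ [ 𝟙 ]   ≡⟨ cong (_++ [ 𝟙 ]) (lower-∷ 𝟘 (raise M) (1≤#⋆-raise M h)) ⟩
  𝟘 ∷ lower (raise M) ++ [ 𝟙 ]   ∎

ℓ∘f≡f∘ℓ-star : ∀ M → 2 ≤ #⋆ M → ℓ (f (star M)) ≡ f (ℓ (star M))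
ℓ∘f≡f∘ℓ-star M h = begin
  ℓ (f (star M))                 ≡⟨ ℓ∘f-star M h ⟩
  𝟘 ∷ lower (raise M) ++ [ 𝟙 ]   ≡⟨ cong (λ v → 𝟘 ∷ v ++ [ 𝟙 ]) (lower∘raise≡raise∘lower M h) ⟩
  𝟘 ∷ raise (lower M) ++ [ 𝟙 ]   ≡⟨ sym (f∘ℓ-star M h) ⟩
  f (ℓ (star M))                 ∎

#⋆-ℓ-star : ∀ M → #⋆ (ℓ (star M)) ≡ #⋆ M
#⋆-ℓ-star M = suc-injective (suc-injective (trans (#⋆-ℓ (star M) h) (#⋆-star M)))
  where
  h : 2 ≤ #⋆ (star M)
  h = subst (2 ≤_) (sym (#⋆-star M)) (s≤s (s≤s z≤n))

-- Children and parents

undo-f : Word → Word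
undo-f (𝟘 ∷ w) = ⋆ ∷ unraise 0 w
undo-f w       = w

undo-ℓ : Word → Word
undo-ℓ w = mirror (undo-f (mirror w))

dropLast : Word → Word
dropLast []          = []
dropLast (x ∷ [])    = []
dropLast (x ∷ y ∷ w) = x ∷ dropLast (y ∷ w)

dropLast-∷ʳ : ∀ w x → dropLast (w ++ [ x ]) ≡ w
dropLast-∷ʳ []          x = refl
dropLast-∷ʳ (y ∷ [])    x = refl
dropLast-∷ʳ (y ∷ z ∷ w) x = cong (y ∷_) (dropLast-∷ʳ (z ∷ w) x)

unstar : Word → Word
unstar w = dropLast (drop 1 w)

unstar-star : ∀ M → unstar (star M) ≡ M
unstar-star M = dropLast-∷ʳ M ⋆

parent : Word → Word
parent x = unstar (undo-ℓ (undo-f x))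

undo-f∘f : ∀ {w} → Chain (⋆ ∷ w) → 1 ≤ #⋆ w → undo-f (f (⋆ ∷ w)) ≡ ⋆ ∷ w
undo-f∘f {w} (flat p) h = begin
  undo-f (f (⋆ ∷ w))     ≡⟨ cong undo-f (f-⋆ w) ⟩
  ⋆ ∷ unraise 0 (raise w) ≡⟨ cong (⋆ ∷_) (unraise-raise p h) ⟩
  ⋆ ∷ w                  ∎

undo-ℓ∘ℓ : ∀ {w} → Chain (w ++ [ ⋆ ]) → 1 ≤ #⋆ w → undo-ℓ (ℓ (w ++ [ ⋆ ])) ≡ w ++ [ ⋆ ]
undo-ℓ∘ℓ {w} c h = begin
  mirror (undo-f (mirror (ℓ (w ++ [ ⋆ ]))))
    ≡⟨ cong (mirror ∘ undo-f ∘ mirror) (ℓ-dual (w ++ [ ⋆ ])) ⟩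
  mirror (undo-f (mirror (mirror (f (mirror (w ++ [ ⋆ ]))))))
    ≡⟨ cong (mirror ∘ undo-f) (mirror-involutive (f (mirror (w ++ [ ⋆ ])))) ⟩
  mirror (undo-f (f (mirror (w ++ [ ⋆ ]))))
    ≡⟨ cong (mirror ∘ undo-f ∘ f) (mirror-∷ʳ w ⋆) ⟩
  mirror (undo-f (f (⋆ ∷ mirror w)))
    ≡⟨ cong mirror (undo-f∘f c′ h′) ⟩
  mirror (⋆ ∷ mirror w)
    ≡⟨ cong mirror (sym (mirror-∷ʳ w ⋆)) ⟩
  mirror (mirror (w ++ [ ⋆ ]))
    ≡⟨ mirror-involutive (w ++ [ ⋆ ]) ⟩
  w ++ [ ⋆ ] ∎
  where
  c′ : Chain (⋆ ∷ mirror w)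
  c′ = subst Chain (mirror-∷ʳ w ⋆) (Path-mirror c)
  h′ : 1 ≤ #⋆ (mirror w)
  h′ = ≤-#⋆-mirror w h

undo-ℓ-∷ʳ⋆ : ∀ w → undo-ℓ (w ++ [ ⋆ ]) ≡ w ++ [ ⋆ ]
undo-ℓ-∷ʳ⋆ w = begin
  mirror (undo-f (mirror (w ++ [ ⋆ ]))) ≡⟨ cong (mirror ∘ undo-f) (mirror-∷ʳ w ⋆) ⟩
  mirror (⋆ ∷ mirror w)                 ≡⟨ cong mirror (sym (mirror-∷ʳ w ⋆)) ⟩
  mirror (mirror (w ++ [ ⋆ ]))          ≡⟨ mirror-involutive (w ++ [ ⋆ ]) ⟩
  w ++ [ ⋆ ]                            ∎

f∘undo-f : ∀ {w} → Chain (𝟘 ∷ w) → f (undo-f (𝟘 ∷ w)) ≡ 𝟘 ∷ w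
f∘undo-f {w} (up p) = trans (f-⋆ (unraise 0 w)) (cong (𝟘 ∷_) (raise-unraise p))

Chain-undo-f : ∀ {w} → Chain (𝟘 ∷ w) → Chain (undo-f (𝟘 ∷ w))
Chain-undo-f (up p) = flat (Path-unraise p)

-- The ℓ-child needs a ⋆ in M: otherwise ℓ(*M*) = f(*M*) = 0M1.
data Child (M : Word) : Word → Set where
  star-child : Child M (star M)
  f-child    : Child M (f (star M))
  ℓ-child    : 1 ≤ #⋆ M → Child M (ℓ (star M))
  fℓ-child   : 2 ≤ #⋆ M → Child M (f (ℓ (star M)))

2≤#⋆-star : ∀ M → 2 ≤ #⋆ (star M)
2≤#⋆-star M = subst (2 ≤_) (sym (#⋆-star M)) (s≤s (s≤s z≤n))

Chain-child : ∀ {M x} → Chain M → Child M x → Chain x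
Chain-child {M} c star-child   = Chain-star c
Chain-child {M} c f-child      = Path-f (Chain-star c) (2≤#⋆-star M)
Chain-child {M} c (ℓ-child _)  = Chain-ℓ (Chain-star c) (2≤#⋆-star M)
Chain-child {M} c (fℓ-child h) =
  Path-f (Chain-ℓ (Chain-star c) (2≤#⋆-star M)) (subst (2 ≤_) (sym (#⋆-ℓ-star M)) h)

length-child : ∀ {M x} → Child M x → length x ≡ 2 + length M
length-child {M} star-child    = length-star M
length-child {M} f-child       = trans (length-f (star M)) (length-star M)
length-child {M} (ℓ-child _)   = trans (length-ℓ (star M)) (length-star M)
length-child {M} (fℓ-child _)  =
  trans (length-f (ℓ (star M))) (trans (length-ℓ (star M)) (length-star M))

undo-f-ℓ-star : ∀ {M} → 1 ≤ #⋆ M → undo-f (ℓ (star M)) ≡ ℓ (star M)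
undo-f-ℓ-star {M} h = trans (cong undo-f (ℓ-star M h)) (sym (ℓ-star M h))

undo-f-fℓ-star : ∀ {M} → Chain M → 2 ≤ #⋆ M → undo-f (f (ℓ (star M))) ≡ ℓ (star M)
undo-f-fℓ-star {M} c h = begin
  undo-f (f (ℓ (star M)))         ≡⟨ cong (undo-f ∘ f) e ⟩
  undo-f (f (⋆ ∷ lower M ++ [ 𝟙 ])) ≡⟨ undo-f∘f (subst Chain e (Chain-child c (ℓ-child h₁))) h′ ⟩
  ⋆ ∷ lower M ++ [ 𝟙 ]             ≡⟨ sym e ⟩
  ℓ (star M)                      ∎
  where
  h₁ : 1 ≤ #⋆ M
  h₁ = <⇒≤ h
  e : ℓ (star M) ≡ ⋆ ∷ lower M ++ [ 𝟙 ]
  e = ℓ-star M h₁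
  h′ : 1 ≤ #⋆ (lower M ++ [ 𝟙 ])
  h′ = ≤-pred (subst (2 ≤_) (trans (sym (#⋆-ℓ-star M)) (cong #⋆ e)) h)

undo-child : ∀ {M x} → Chain M → Child M x → undo-ℓ (undo-f x) ≡ star M
undo-child {M} c star-child    = undo-ℓ-∷ʳ⋆ (⋆ ∷ M)
undo-child {M} c f-child       =
  trans (cong undo-ℓ (undo-f∘f (Chain-star c) (1≤#⋆-∷ʳ⋆ M))) (undo-ℓ-∷ʳ⋆ (⋆ ∷ M))
undo-child {M} c (ℓ-child h)   =
  trans (cong undo-ℓ (undo-f-ℓ-star {M} h)) (undo-ℓ∘ℓ {⋆ ∷ M} (Chain-star c) (s≤s z≤n))
undo-child {M} c (fℓ-child h)  =
  trans (cong undo-ℓ (undo-f-fℓ-star c h)) (undo-ℓ∘ℓ {⋆ ∷ M} (Chain-star c) (s≤s z≤n))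

parent-child : ∀ {M x} → Chain M → Child M x → parent x ≡ M
parent-child {M} c ch = trans (cong unstar (undo-child c ch)) (unstar-star M)

lowered-view : ∀ {v} → Chain (⋆ ∷ v ++ [ 𝟙 ]) →
  ∃ λ M → Chain M × 1 ≤ #⋆ M × ℓ (star M) ≡ ⋆ ∷ v ++ [ 𝟙 ]
lowered-view {v} c with subst Chain (mirror-wrap ⋆ v 𝟙) (Path-mirror c)
... | up p with Path-++⁻ (mirror v) p
...   | _ , q , flat end = mirror B , Path-mirror (Path-unraise q) , hM , e
  where
  B : Word
  B = unraise 0 (mirror v)
  hB : 1 ≤ #⋆ B
  hB = subst (1 ≤_) (sym (#⋆-unraise q)) (s≤s z≤n)
  hM : 1 ≤ #⋆ (mirror B)
  hM = ≤-#⋆-mirror B hB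
  e : ℓ (star (mirror B)) ≡ ⋆ ∷ v ++ [ 𝟙 ]
  e = begin
    ℓ (star (mirror B))
      ≡⟨ ℓ-dual (star (mirror B)) ⟩
    mirror (f (mirror (star (mirror B))))
      ≡⟨ cong (mirror ∘ f) (trans (mirror-star (mirror B)) (cong star (mirror-involutive B))) ⟩
    mirror (f (star B))
      ≡⟨ cong mirror (f-star B hB) ⟩
    mirror (𝟘 ∷ raise B ++ [ ⋆ ])
      ≡⟨ cong (λ u → mirror (𝟘 ∷ u ++ [ ⋆ ])) (raise-unraise q) ⟩
    mirror (𝟘 ∷ mirror v ++ [ ⋆ ])
      ≡⟨ cong mirror (sym (mirror-wrap ⋆ v 𝟙)) ⟩
    mirror (mirror (⋆ ∷ v ++ [ 𝟙 ]))
      ≡⟨ mirror-involutive (⋆ ∷ v ++ [ 𝟙 ]) ⟩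
    ⋆ ∷ v ++ [ 𝟙 ] ∎

star-headed-view : ∀ {w} → Chain (⋆ ∷ w) → 1 ≤ length w →
  ∃ λ M → Chain M × (star M ≡ ⋆ ∷ w ⊎ (ℓ (star M) ≡ ⋆ ∷ w × 1 ≤ #⋆ M))
star-headed-view {w} c h with initLast w
star-headed-view c () | []
... | v ∷ʳ′ ⋆ = v , Chain-star⁻ c , inj₁ refl
... | v ∷ʳ′ 𝟘 = ⊥-elim (¬Chain-∷ʳ𝟘 (⋆ ∷ v) c)
... | v ∷ʳ′ 𝟙 = let M , cM , hM , e = lowered-view c in M , cM , inj₂ (e , hM)

∃-parent : ∀ {x} → Chain x → 2 ≤ length x → ∃ λ M → Chain M × Child M x
∃-parent {⋆ ∷ w} c (s≤s h) with star-headed-view c h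
... | M , cM , inj₁ e        = M , cM , subst (Child M) e star-child
... | M , cM , inj₂ (e , hM) = M , cM , subst (Child M) e (ℓ-child hM)
∃-parent {𝟘 ∷ w} c@(up p) (s≤s h)
  with star-headed-view (Chain-undo-f c) (subst (1 ≤_) (sym (length-unraise 0 w)) h)
... | M , cM , inj₁ e       = M , cM , subst (Child M) (trans (cong f e) (f∘undo-f c)) f-child
... | M , cM , inj₂ (e , _) = M , cM , subst (Child M) (trans (cong f e) (f∘undo-f c)) (fℓ-child h₂)
  where
  h₂ : 2 ≤ #⋆ M
  h₂ = subst (2 ≤_) (begin
         suc (suc (#⋆ w)) ≡⟨ cong suc (sym (#⋆-unraise p)) ⟩
         #⋆ (⋆ ∷ unraise 0 w) ≡⟨ cong #⋆ (sym e) ⟩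
         #⋆ (ℓ (star M)) ≡⟨ #⋆-ℓ-star M ⟩
         #⋆ M ∎) (s≤s (s≤s z≤n))

parent-spec : ∀ {x} → Chain x → 2 ≤ length x → Chain (parent x) × Child (parent x) x
parent-spec c h with ∃-parent c h
... | M , cM , ch rewrite parent-child cM ch = cM , ch

lowerings : Word → ℕ → List Word
lowerings M zero          = []
lowerings M (suc zero)    = ℓ (star M) ∷ []
lowerings M (suc (suc _)) = ℓ (star M) ∷ f (ℓ (star M)) ∷ []

childList : Word → List Word
childList M = star M ∷ f (star M) ∷ lowerings M (#⋆ M)

childList-children : ∀ M → All (Child M) (childList M)
childList-children M = star-child ∷ f-child ∷ lowerings-children (#⋆ M) ≤-refl
  where
  lowerings-children : ∀ k → k ≤ #⋆ M → All (Child M) (lowerings M k)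
  lowerings-children zero          h = []
  lowerings-children (suc zero)    h = ℓ-child h ∷ []
  lowerings-children (suc (suc k)) h = ℓ-child (<⇒≤ h₂) ∷ fℓ-child h₂ ∷ []
    where
    h₂ = ≤-trans (s≤s (s≤s z≤n)) h

child∈childList : ∀ {M x} → Child M x → x ∈ childList M
child∈childList star-child         = here refl
child∈childList f-child            = there (here refl)
child∈childList {M} (ℓ-child h)    = there (there (ℓ∈lowerings (#⋆ M) h))
  where
  ℓ∈lowerings : ∀ k → 1 ≤ k → ℓ (star M) ∈ lowerings M k
  ℓ∈lowerings (suc zero)    _ = here refl
  ℓ∈lowerings (suc (suc k)) _ = here refl
child∈childList {M} (fℓ-child h)   = there (there (fℓ∈lowerings (#⋆ M) h))
  where
  fℓ∈lowerings : ∀ k → 2 ≤ k → f (ℓ (star M)) ∈ lowerings M k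
  fℓ∈lowerings (suc zero)    (s≤s ())
  fℓ∈lowerings (suc (suc k)) _ = there (here refl)

head-differs : ∀ {a b : Sym} u v → a ≢ b → a ∷ u ≢ b ∷ v
head-differs u v a≢b e = a≢b (∷-injectiveˡ e)

last-differs : ∀ {a b : Sym} u v → a ≢ b → u ++ [ a ] ≢ v ++ [ b ]
last-differs u v a≢b e = a≢b (proj₂ (∷ʳ-injective u v e))

unique-childList : ∀ M → Unique (childList M)
unique-childList M = unique (#⋆ M) ≤-refl
  where
  s≢f : star M ≢ f (star M)
  s≢f = head-differs _ _ λ ()
  s≢ℓ : 1 ≤ #⋆ M → star M ≢ ℓ (star M)
  s≢ℓ h e = last-differs (⋆ ∷ M) (⋆ ∷ lower M) (λ ()) (trans e (ℓ-star M h))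
  s≢fℓ : 2 ≤ #⋆ M → star M ≢ f (ℓ (star M))
  s≢fℓ h e = head-differs _ _ (λ ()) (trans e (f∘ℓ-star M h))
  f≢ℓ : 1 ≤ #⋆ M → f (star M) ≢ ℓ (star M)
  f≢ℓ h e = head-differs _ _ (λ ()) (trans e (ℓ-star M h))
  f≢fℓ : 2 ≤ #⋆ M → f (star M) ≢ f (ℓ (star M))
  f≢fℓ h e = last-differs (𝟘 ∷ raise M) (𝟘 ∷ raise (lower M)) (λ ())
    (trans (sym (f-star M (<⇒≤ h))) (trans e (f∘ℓ-star M h)))
  ℓ≢fℓ : 2 ≤ #⋆ M → ℓ (star M) ≢ f (ℓ (star M))
  ℓ≢fℓ h e = head-differs _ _ (λ ())
    (trans (sym (ℓ-star M (<⇒≤ h))) (trans e (f∘ℓ-star M h)))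
  unique : ∀ k → k ≤ #⋆ M → Unique (star M ∷ f (star M) ∷ lowerings M k)
  unique zero          h = (s≢f ∷ []) ∷ [] ∷ []
  unique (suc zero)    h = (s≢f ∷ s≢ℓ h ∷ []) ∷ (f≢ℓ h ∷ []) ∷ [] ∷ []
  unique (suc (suc k)) h =
    (s≢f ∷ s≢ℓ (<⇒≤ h₂) ∷ s≢fℓ h₂ ∷ []) ∷ (f≢ℓ (<⇒≤ h₂) ∷ f≢fℓ h₂ ∷ []) ∷ (ℓ≢fℓ h₂ ∷ []) ∷ [] ∷ []
    where
    h₂ = ≤-trans (s≤s (s≤s z≤n)) h

λeven↭childList : ∀ M → even? (#⋆ M) ≡ true → λeven M ↭ childList M
λeven↭childList M e with #⋆ M in eq
... | zero          = ↭-reflexive (cong (λ u → star M ∷ u ∷ []) (sym (f-star-starFree M eq)))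
λeven↭childList M () | suc zero
... | suc (suc k)   = prep _ (prep _ (swap _ _ ↭-refl))

λodd↭childList : ∀ M → even? (#⋆ M) ≡ false → λodd M ↭ childList M
λodd↭childList M e with #⋆ M in eq
λodd↭childList M () | zero
... | suc zero      = prep _ (swap _ _ ↭-refl)
... | suc (suc k)   =
  prep _ (↭-trans (prep _ (swap _ _ ↭-refl)) (swap _ _ (↭-reflexive (cong [_] ℓf≡fℓ))))
  where
  ℓf≡fℓ : ℓ (f (star M)) ≡ f (ℓ (star M))
  ℓf≡fℓ = ℓ∘f≡f∘ℓ-star M (subst (2 ≤_) (sym eq) (s≤s (s≤s z≤n)))

even?-suc : ∀ n → even? (suc n) ≡ not (even? n)
even?-suc zero          = refl
even?-suc (suc zero)    = refl
even?-suc (suc (suc n)) = even?-suc n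

even?-double : ∀ n → even? (n + n) ≡ true
even?-double zero    = refl
even?-double (suc n) rewrite +-suc n n = even?-double n

even?-Path : ∀ {i w j} → Path i w j → even? (length w + (i + j)) ≡ even? (#⋆ w)
even?-Path {i} end = even?-double i
even?-Path {i} {𝟘 ∷ w} {j} (up p) rewrite sym (+-suc (length w) (i + j)) = even?-Path p
even?-Path {suc i} {𝟙 ∷ w} {j} (down p) rewrite +-suc (length w) (i + j) = even?-Path p
even?-Path {w = ⋆ ∷ w} {j} (flat p) =
  trans (even?-suc (length w + j)) (trans (cong not (even?-Path p)) (sym (even?-suc (#⋆ w))))

even?-Chain : ∀ {w} → Chain w → even? (length w) ≡ even? (#⋆ w)
even?-Chain {w} c = trans (cong even? (sym (+-identityʳ (length w)))) (even?-Path c)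

ρ↭λ : ∀ n M → ρ n M ↭ (if even? n then λeven M else λodd M)
ρ↭λ n M with (#⋆ M % 4) ≡ᵇ (n % 4)
... | true  = ↭-refl
... | false = ↭-reverse _

λ↭childList : ∀ b M → even? (#⋆ M) ≡ b → (if b then λeven M else λodd M) ↭ childList M
λ↭childList true  = λeven↭childList
λ↭childList false = λodd↭childList

ρ↭childList : ∀ {n M} → Chain M → length M ≡ n → ρ n M ↭ childList M
ρ↭childList {M = M} c refl =
  ↭-trans (ρ↭λ (length M) M) (λ↭childList (even? (length M)) M (sym (even?-Chain c)))

==ˢ⇒≡ : ∀ a b → (a ==ˢ b) ≡ true → a ≡ b
==ˢ⇒≡ 𝟘 𝟘 _  = refl
==ˢ⇒≡ 𝟙 𝟙 _  = refl
==ˢ⇒≡ ⋆ ⋆ _  = refl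
==ˢ⇒≡ 𝟘 𝟙 ()
==ˢ⇒≡ 𝟘 ⋆ ()
==ˢ⇒≡ 𝟙 𝟘 ()
==ˢ⇒≡ 𝟙 ⋆ ()
==ˢ⇒≡ ⋆ 𝟘 ()
==ˢ⇒≡ ⋆ 𝟙 ()

==⇒≡ : ∀ v w → (v == w) ≡ true → v ≡ w
==⇒≡ []      []      _ = refl
==⇒≡ (x ∷ v) (y ∷ w) h with x ==ˢ y in e
... | true = cong₂ _∷_ (==ˢ⇒≡ x y e) (==⇒≡ v w h)

==-refl : ∀ w → (w == w) ≡ true
==-refl []      = refl
==-refl (𝟘 ∷ w) = ==-refl w
==-refl (𝟙 ∷ w) = ==-refl w
==-refl (⋆ ∷ w) = ==-refl w

_≟_ : DecidableEquality Word
v ≟ w with v == w in e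
... | true  = yes (==⇒≡ v w e)
... | false = no λ { refl → true≢false (trans (sym (==-refl v)) e) }
  where
  true≢false : true ≢ false
  true≢false ()

multiplicity-here : ∀ x L → multiplicity x (x ∷ L) ≡ suc (multiplicity x L)
multiplicity-here x L rewrite ==-refl x = refl

multiplicity-there : ∀ {x y} L → x ≢ y → multiplicity x (y ∷ L) ≡ multiplicity x L
multiplicity-there {x} {y} L x≢y with x == y in e
... | true  = ⊥-elim (x≢y (==⇒≡ x y e))
... | false = refl

multiplicity-∷ : ∀ x y L → multiplicity x (y ∷ L) ≡ multiplicity x [ y ] + multiplicity x L
multiplicity-∷ x y L with x == y
... | true  = refl
... | false = refl

multiplicity-++ : ∀ x a b → multiplicity x (a ++ b) ≡ multiplicity x a + multiplicity x b
multiplicity-++ x []      b = refl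
multiplicity-++ x (y ∷ a) b with x == y
... | true  = cong suc (multiplicity-++ x a b)
... | false = multiplicity-++ x a b

multiplicity-↭ : ∀ {x L L′} → L ↭ L′ → multiplicity x L ≡ multiplicity x L′
multiplicity-↭ Perm.refl = refl
multiplicity-↭ {x} (Perm.prep y p) with x == y
... | true  = cong suc (multiplicity-↭ p)
... | false = multiplicity-↭ p
multiplicity-↭ {x} (Perm.swap y z p) with x == y | x == z
... | true  | true  = cong (suc ∘ suc) (multiplicity-↭ p)
... | true  | false = cong suc (multiplicity-↭ p)
... | false | true  = cong suc (multiplicity-↭ p)
... | false | false = multiplicity-↭ p
multiplicity-↭ (Perm.trans p q) = trans (multiplicity-↭ p) (multiplicity-↭ q)

multiplicity-absent : ∀ {x L} → All (x ≢_) L → multiplicity x L ≡ 0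
multiplicity-absent []                          = refl
multiplicity-absent {L = _ ∷ L} (x≢y ∷ x∉L) =
  trans (multiplicity-there L x≢y) (multiplicity-absent x∉L)

multiplicity-unique : ∀ {x L} → Unique L → x ∈ L → multiplicity x L ≡ 1
multiplicity-unique {x} {_ ∷ L} (x∉L ∷ _) (here refl) =
  trans (multiplicity-here x L) (cong suc (multiplicity-absent x∉L))
multiplicity-unique {L = _ ∷ L} (y∉L ∷ u) (there x∈L) =
  trans (multiplicity-there L (λ x≡y → All.lookup y∉L x∈L (sym x≡y))) (multiplicity-unique u x∈L)

multiplicity-concatMap : ∀ (g : Word → List Word) x y L →
  All (λ D → multiplicity x (g D) ≡ multiplicity y [ D ]) L →
  multiplicity x (concatMap g L) ≡ multiplicity y L
multiplicity-concatMap g x y []      []       = refl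
multiplicity-concatMap g x y (D ∷ L) (e ∷ es) = begin
  multiplicity x (g D ++ concatMap g L)
    ≡⟨ multiplicity-++ x (g D) (concatMap g L) ⟩
  multiplicity x (g D) + multiplicity x (concatMap g L)
    ≡⟨ cong₂ _+_ e (multiplicity-concatMap g x y L es) ⟩
  multiplicity y [ D ] + multiplicity y L
    ≡⟨ sym (multiplicity-∷ y D L) ⟩
  multiplicity y (D ∷ L) ∎

multiplicity-ρ : ∀ {n D x} → Chain D → length D ≡ n → Chain x → 2 ≤ length x →
  multiplicity x (ρ n D) ≡ multiplicity (parent x) [ D ]
multiplicity-ρ {D = D} {x = x} cD lD cx lx =
  trans (multiplicity-↭ (ρ↭childList cD lD)) (multiplicity-childList (parent x ≟ D))
  where
  x∉children : parent x ≢ D → ∀ {y} → Child D y → x ≢ y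
  x∉children p≢D ch refl = p≢D (parent-child cD ch)
  multiplicity-childList : Dec (parent x ≡ D) →
                           multiplicity x (childList D) ≡ multiplicity (parent x) [ D ]
  multiplicity-childList (yes refl) =
    trans (multiplicity-unique (unique-childList D) (child∈childList (proj₂ (parent-spec cx lx))))
          (sym (multiplicity-here D []))
  multiplicity-childList (no p≢D) =
    trans (multiplicity-absent (All.map (x∉children p≢D) (childList-children D)))
          (sym (multiplicity-there [] p≢D))

-- Dyck words and the sequences Λ n

DyckFrom : ℕ → Word → Set
DyckFrom k u = All IsBit u × (k + #0 u ≡ #1 u) × (∀ (p s : Word) → p ++ s ≡ u → #1 p ≤ k + #0 p)

DyckFrom⇒Path : ∀ k u → DyckFrom k u → Path k u 0
DyckFrom⇒Path k [] (_ , e , _) = subst (λ i → Path i [] 0) (sym (trans (sym (+-identityʳ k)) e)) end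
DyckFrom⇒Path k (𝟘 ∷ u) (_ ∷ bits , e , prefix) =
  up (DyckFrom⇒Path (suc k) u (bits , trans (sym (+-suc k (#0 u))) e , prefix′))
  where
  prefix′ : ∀ p s → p ++ s ≡ u → #1 p ≤ suc k + #0 p
  prefix′ p s eq = subst (#1 p ≤_) (+-suc k (#0 p)) (prefix (𝟘 ∷ p) s (cong (𝟘 ∷_) eq))
DyckFrom⇒Path zero (𝟙 ∷ u) (_ , _ , prefix) with () ← prefix [ 𝟙 ] u refl
DyckFrom⇒Path (suc k) (𝟙 ∷ u) (_ ∷ bits , e , prefix) =
  down (DyckFrom⇒Path k u (bits , suc-injective e , prefix′))
  where
  prefix′ : ∀ p s → p ++ s ≡ u → #1 p ≤ k + #0 p
  prefix′ p s eq = ≤-pred (prefix (𝟙 ∷ p) s (cong (𝟙 ∷_) eq))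
DyckFrom⇒Path k (⋆ ∷ u) (inj₁ () ∷ _ , _)
DyckFrom⇒Path k (⋆ ∷ u) (inj₂ () ∷ _ , _)

Path⇒DyckFrom : ∀ {k u} → Path k u 0 → #⋆ u ≡ 0 → DyckFrom k u
Path⇒DyckFrom end _ = [] , refl , λ { [] _ _ → z≤n }
Path⇒DyckFrom {k} {𝟘 ∷ u} (up p) h =
  let bits , e , prefix = Path⇒DyckFrom p h in
  inj₁ refl ∷ bits , trans (+-suc k (#0 u)) e ,
  λ { [] _ _ → z≤n ; (𝟘 ∷ q) s refl → subst (#1 q ≤_) (sym (+-suc k (#0 q))) (prefix q s refl) }
Path⇒DyckFrom {suc k} {𝟙 ∷ u} (down p) h =
  let bits , e , prefix = Path⇒DyckFrom p h in
  inj₂ refl ∷ bits , cong suc e ,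
  λ { [] _ _ → z≤n ; (𝟙 ∷ q) s refl → s≤s (prefix q s refl) }

starBlocks : List Word → Word
starBlocks []       = []
starBlocks (u ∷ us) = ⋆ ∷ u ++ starBlocks us

concat-intersperse-⋆ : ∀ u₀ us → concat (intersperse [ ⋆ ] (u₀ ∷ us)) ≡ u₀ ++ starBlocks us
concat-intersperse-⋆ u₀ []       = refl
concat-intersperse-⋆ u₀ (u ∷ us) = cong (λ w → u₀ ++ ⋆ ∷ w) (concat-intersperse-⋆ u us)

Chain-starBlocks : ∀ {u₀ us} → All InD (u₀ ∷ us) → Chain (u₀ ++ starBlocks us)
Chain-starBlocks {u₀} {[]}     (d ∷ [])  = Path-++ (DyckFrom⇒Path 0 u₀ d) end
Chain-starBlocks {u₀} {u ∷ us} (d ∷ ds)  =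
  Path-++ (DyckFrom⇒Path 0 u₀ d) (flat (Chain-starBlocks ds))

Path-starBlocks : ∀ {k w} → Path k w 0 →
  ∃ λ u₀ → ∃ λ us → (Path k u₀ 0 × #⋆ u₀ ≡ 0) × All InD us × w ≡ u₀ ++ starBlocks us
Path-starBlocks end = [] , [] , (end , refl) , [] , refl
Path-starBlocks (up p) =
  let u₀ , us , (q , h) , ds , e = Path-starBlocks p in
  𝟘 ∷ u₀ , us , (up q , h) , ds , cong (𝟘 ∷_) e
Path-starBlocks (down p) =
  let u₀ , us , (q , h) , ds , e = Path-starBlocks p in
  𝟙 ∷ u₀ , us , (down q , h) , ds , cong (𝟙 ∷_) e
Path-starBlocks (flat p) =
  let u₀ , us , (q , h) , ds , e = Path-starBlocks p in
  [] , u₀ ∷ us , (end , refl) , Path⇒DyckFrom q h ∷ ds , cong (⋆ ∷_) e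

IsGKChain⇒Chain : ∀ {n C} → IsGKChain n C → Chain C × length C ≡ n
IsGKChain⇒Chain (l , u₀ , us , ds , refl) =
  subst Chain (sym (concat-intersperse-⋆ u₀ us)) (Chain-starBlocks ds) , l

Chain⇒IsGKChain : ∀ {n C} → Chain C → length C ≡ n → IsGKChain n C
Chain⇒IsGKChain c l =
  let u₀ , us , (q , h) , ds , e = Path-starBlocks c in
  l , u₀ , us , Path⇒DyckFrom q h ∷ ds , trans e (sym (concat-intersperse-⋆ u₀ us))

Λ-chains : ∀ n → All (λ C → Chain C × length C ≡ n) (Λ n)
Λ-chains zero          = (end , refl) ∷ []
Λ-chains (suc zero)    = (flat end , refl) ∷ []
Λ-chains (suc (suc n)) = concat⁺ (map⁺ (All.map children-chains (Λ-chains n)))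
  where
  children-chains : ∀ {D} → Chain D × length D ≡ n →
                    All (λ C → Chain C × length C ≡ suc (suc n)) (ρ n D)
  children-chains {D} (c , l) =
    All-resp-↭ (↭-sym (ρ↭childList c l))
      (All.map (λ ch → Chain-child c ch , trans (length-child ch) (cong (2 +_) l)) (childList-children D))

Λ-complete : ∀ n {C} → Chain C → length C ≡ n → multiplicity C (Λ n) ≡ 1
Λ-complete zero          {[]}         _      _ = refl
Λ-complete (suc zero)    {⋆ ∷ []}     _      _ = refl
Λ-complete (suc zero)    {𝟘 ∷ []}     (up ()) _
Λ-complete (suc (suc n)) {C}          c      l = begin
  multiplicity C (concatMap (ρ n) (Λ n))
    ≡⟨ multiplicity-concatMap (ρ n) C (parent C) (Λ n)
         (All.map (λ (cD , lD) → multiplicity-ρ cD lD c h) (Λ-chains n)) ⟩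
  multiplicity (parent C) (Λ n)
    ≡⟨ Λ-complete n cP (suc-injective (suc-injective (trans (sym (length-child chP)) l))) ⟩
  1 ∎
  where
  h : 2 ≤ length C
  h = subst (2 ≤_) (sym l) (s≤s (s≤s z≤n))
  cP = proj₁ (parent-spec c h)
  chP = proj₂ (parent-spec c h)

lemma17 : ∀ (n : ℕ) →
    (∀ (C : Word) → IsGKChain n C → multiplicity C (Λ n) ≡ 1)
    × (∀ (C : Word) → C ∈ Λ n → IsGKChain n C)
lemma17 n =
  (λ C g → let c , l = IsGKChain⇒Chain g in Λ-complete n c l) ,
  (λ C C∈Λ → let c , l = All.lookup (Λ-chains n) C∈Λ in Chain⇒IsGKChain c l)
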